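{- Let $\mathbf{f}=\{f_1,\dots,f_{r}\}\subseteq\mathbb{Q}[x_1,\dots,x_n]$ be a system of forms of degree $d>1$ with $h(\mathbf{f})>1$. Then for every $1\le i\le n$, $$h(\mathbf{f})-1\le h(\mathbf{f}|_{x_i=0})\le h(\mathbf{f}),$$ where $\mathbf{f}|_{x_i=0}=\{f_1|_{x_i=0},\dots,f_r|_{x_i=0}\}$.
   Context: $f|_{x_i=0}=f(x_1,\dots,x_{i-1},0,x_{i+1},\dots,x_n)$. $h$-invariant of a form: for a form $f\in\mathbb{Q}[x_1,\dots,x_n]$ of degree at least $2$, $h(f)$ is the least positive integer $h$ such that $f=U_1V_1+\dots+U_hV_h$ identically with all $U_i,V_i$ forms in $\mathbb{Q}[x_1,\dots,x_n]$ of degree at least $1$; $h(0)=0$. For a system $\mathbf{f}=\{f_1,\dots,f_r\}$ of forms of the same degree, $h(\mathbf{f})=\min_{\boldsymbol\mu\in\mathbb{Q}^r\setminus\{\mathbf{0}\}}h(\mu_1f_1+\dots+\mu_rf_r)$. -}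

module Defs where

open import Data.Nat using (ℕ; zero; suc; _≤_; _∸_)
open import Data.Fin using (Fin; zero; suc)
open import Data.Vec using (Vec; []; _∷_; lookup; zipWith)
import Data.Vec as Vec
open import Data.List using (List; []; _∷_; concatMap; upTo; map; foldr)
open import Data.Rational using (ℚ; 0ℚ; _+_; _*_)
open import Data.Product using (Σ; _×_)
open import Relation.Binary.PropositionalEquality using (_≡_)
open import Relation.Nullary using (¬_)

-- A monomial x₁^{m₁}⋯xₙ^{mₙ} is its exponent vector.
Mono : ℕ → Set
Mono n = Vec ℕ n

mdeg : ∀ {n} → Mono n → ℕ
mdeg = Vec.sum

-- An element of ℚ[[x₁,…,xₙ]] given by its coefficient function.
-- Forms (homogeneous polynomials) are the elements satisfying IsForm below;
-- they have finite support, so they are exactly the forms of ℚ[x₁,…,xₙ].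
Poly : ℕ → Set
Poly n = Mono n → ℚ

-- p is a form of degree e (the zero polynomial counts as a form of every degree)
IsForm : ∀ {n} → ℕ → Poly n → Set
IsForm e p = ∀ m → ¬ (mdeg m ≡ e) → p m ≡ 0ℚ

below : ∀ {n} → Mono n → List (Mono n)
below [] = [] ∷ []
below (k ∷ m) = concatMap (λ c → map (c ∷_) (below m)) (upTo (suc k))

sumL : List ℚ → ℚ
sumL = foldr _+_ 0ℚ

zeroP : ∀ {n} → Poly n
zeroP _ = 0ℚ

addP : ∀ {n} → Poly n → Poly n → Poly n
addP p q m = p m + q m

scaleP : ∀ {n} → ℚ → Poly n → Poly n
scaleP c p m = c * p m

mulP : ∀ {n} → Poly n → Poly n → Poly n
mulP p q m = sumL (map (λ a → p a * q (zipWith _∸_ m a)) (below m))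

sumFin : ∀ {n} (h : ℕ) → (Fin h → Poly n) → Poly n
sumFin zero g = zeroP
sumFin (suc h) g = addP (g zero) (sumFin h (λ k → g (suc k)))

restrictCoeff : ∀ {n} → ℕ → Poly n → Mono n → ℚ
restrictCoeff zero p m = p m
restrictCoeff (suc _) p m = 0ℚ

restrict : ∀ {n} → Fin n → Poly n → Poly n
restrict i p m = restrictCoeff (lookup m i) p m

HasRep : ∀ {n} → Poly n → ℕ → Set
HasRep {n} f h =
  Σ (Fin h → Poly n) λ U → Σ (Fin h → Poly n) λ V →
    (∀ k → Σ ℕ λ a → 1 ≤ a × IsForm a (U k)) ×
    (∀ k → Σ ℕ λ b → 1 ≤ b × IsForm b (V k)) ×
    (∀ m → f m ≡ sumFin h (λ k → mulP (U k) (V k)) m)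

-- h(f) = k : k is the least h with a representation (h(0) = 0 via the empty sum)
IsH : ∀ {n} → Poly n → ℕ → Set
IsH f k = HasRep f k × (∀ j → HasRep f j → k ≤ j)

comb : ∀ {n r} → (Fin r → ℚ) → (Fin r → Poly n) → Poly n
comb {r = r} μ fs = sumFin r (λ j → scaleP (μ j) (fs j))

NonZeroVec : ∀ {r} → (Fin r → ℚ) → Set
NonZeroVec μ = ¬ (∀ j → μ j ≡ 0ℚ)

IsHSys : ∀ {n r} → (Fin r → Poly n) → ℕ → Set
IsHSys {r = r} fs k =
  (Σ (Fin r → ℚ) λ μ → NonZeroVec μ × IsH (comb μ fs) k) ×
  (∀ (μ : Fin r → ℚ) → NonZeroVec μ → ∀ j → HasRep (comb μ fs) j → k ≤ j)

{-# OPTIONS --safe #-}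
module Submission where

open import Defs
open import Data.Nat using (ℕ; _≤_; _∸_)
open import Data.Fin using (Fin)
open import Data.Product using (_×_)

open import Algebra.Bundles using (CommutativeMonoid)
open import Data.Nat using (zero; suc; z≤n; s≤s) renaming (_+_ to _+ℕ_)
open import Data.Nat.Properties using (∸-monoˡ-≤; +-suc; suc-injective; n≤0⇒n≡0; 0∸n≡0; ≤-pred; ≤-refl)
open import Data.Fin using (zero; suc)
open import Data.Vec using ([]; _∷_; lookup; zipWith; replicate; updateAt)
open import Data.Vec.Properties using (lookup-zipWith; zipWith-identityʳ)
open import Data.Vec.Relation.Binary.Pointwise.Inductive as Pointwise using (Pointwise; []; _∷_)
import Data.Vec.Functional as Vector
open import Data.List using (List; []; _∷_; _++_; map; concatMap; upTo)
open import Data.List.Properties using (map-++; map-∘; map-cong; map-cong-local; map-applyUpTo; map-upTo)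
import Data.List.Relation.Unary.All as All
open import Data.List.Relation.Unary.Any using (here)
open import Data.List.Membership.Propositional using (_∈_; find)
open import Data.List.Membership.Propositional.Properties using (∈-map⁻; ∈-concatMap⁻; ∈-upTo⁻)
open import Data.Rational using (ℚ; 0ℚ; 1ℚ; _+_; _*_)
open import Data.Rational.Properties using (+-identityˡ; +-identityʳ; +-assoc; *-zeroˡ; *-zeroʳ; *-identityˡ; *-1-commutativeMonoid)
open import Algebra.Properties.CommutativeSemigroup (CommutativeMonoid.commutativeSemigroup *-1-commutativeMonoid) using (xy∙z≈y∙xz; x∙yz≈y∙xz)
open import Data.Product using (_,_; map₂)
open import Data.Empty using (⊥-elim)
open import Function using (_∘_)
open import Relation.Binary.PropositionalEquality using (_≡_; refl; sym; trans; cong; cong₂; subst; module ≡-Reasoning)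

-- Substituting x_i = 0 is a ring homomorphism that maps forms of degree e to
-- forms of degree e, so a representation of μ·𝐟 as a sum of h products
-- restricts to one of μ·(𝐟|_{x_i=0}); this gives h(𝐟|_{x_i=0}) ≤ h(𝐟).
-- Conversely a form g of degree d ≥ 2 splits as g = x_i·g′ + g|_{x_i=0} with
-- g′ a form of degree d − 1 ≥ 1, so h products for μ·(𝐟|_{x_i=0}) give h + 1
-- products for μ·𝐟, whence h(𝐟) ≤ h(𝐟|_{x_i=0}) + 1.

open ≡-Reasoning

sumMap : ∀ {A : Set} → (A → ℚ) → List A → ℚ
sumMap f xs = sumL (map f xs)

sumL-++ : ∀ xs ys → sumL (xs ++ ys) ≡ sumL xs + sumL ys
sumL-++ [] ys = sym (+-identityˡ _)
sumL-++ (x ∷ xs) ys = trans (cong (x +_) (sumL-++ xs ys)) (sym (+-assoc x _ _))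

sumMap-concatMap : ∀ {A B : Set} (f : B → ℚ) (g : A → List B) xs →
                   sumMap f (concatMap g xs) ≡ sumMap (sumMap f ∘ g) xs
sumMap-concatMap f g [] = refl
sumMap-concatMap f g (x ∷ xs) = begin
  sumL (map f (g x ++ concatMap g xs))        ≡⟨ cong sumL (map-++ f (g x) (concatMap g xs)) ⟩
  sumL (map f (g x) ++ map f (concatMap g xs)) ≡⟨ sumL-++ (map f (g x)) _ ⟩
  sumMap f (g x) + sumMap f (concatMap g xs)   ≡⟨ cong (sumMap f (g x) +_) (sumMap-concatMap f g xs) ⟩
  sumMap f (g x) + sumMap (sumMap f ∘ g) xs    ∎

sumMap-cong : ∀ {A : Set} {f g : A → ℚ} → (∀ x → f x ≡ g x) → ∀ xs → sumMap f xs ≡ sumMap g xs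
sumMap-cong f≗g xs = cong sumL (map-cong f≗g xs)

sumMap-cong-∈ : ∀ {A : Set} {f g : A → ℚ} xs → (∀ {x} → x ∈ xs → f x ≡ g x) → sumMap f xs ≡ sumMap g xs
sumMap-cong-∈ xs f≗g = cong sumL (map-cong-local (All.tabulate f≗g))

sumMap-zero : ∀ {A : Set} {f : A → ℚ} → (∀ x → f x ≡ 0ℚ) → ∀ xs → sumMap f xs ≡ 0ℚ
sumMap-zero f≗0 [] = refl
sumMap-zero f≗0 (x ∷ xs) = trans (cong₂ _+_ (f≗0 x) (sumMap-zero f≗0 xs)) (+-identityˡ 0ℚ)

sumMap-upTo-suc : ∀ (f : ℕ → ℚ) k → sumMap f (upTo (suc k)) ≡ f 0 + sumMap (f ∘ suc) (upTo k)
sumMap-upTo-suc f k = cong (λ xs → f 0 + sumL xs) (trans (map-applyUpTo suc f k) (sym (map-upTo (f ∘ suc) k)))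

sumFin-cong : ∀ {n} h {g g′ : Fin h → Poly n} → (∀ k m → g k m ≡ g′ k m) → ∀ m → sumFin h g m ≡ sumFin h g′ m
sumFin-cong zero g≗g′ m = refl
sumFin-cong (suc h) g≗g′ m = cong₂ _+_ (g≗g′ zero m) (sumFin-cong h (g≗g′ ∘ suc) m)

sumMap-below-∷ : ∀ {n} (F : Mono (suc n) → ℚ) k (m : Mono n) →
                 sumMap F (below (k ∷ m)) ≡ sumMap (λ c → sumMap (F ∘ (c ∷_)) (below m)) (upTo (suc k))
sumMap-below-∷ F k m = trans (sumMap-concatMap F (λ c → map (c ∷_) (below m)) (upTo (suc k)))
  (sumMap-cong (λ c → cong sumL (sym (map-∘ (below m)))) (upTo (suc k)))

∈-below⁻ : ∀ {n} {a m : Mono n} → a ∈ below m → Pointwise _≤_ a m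
∈-below⁻ {m = []} (here refl) = []
∈-below⁻ {m = k ∷ m} a∈ with find (∈-concatMap⁻ (λ c → map (c ∷_) (below m)) {xs = upTo (suc k)} a∈)
... | c , c∈ , a∈′ with ∈-map⁻ (c ∷_) a∈′
... | a′ , a′∈ , refl = ≤-pred (∈-upTo⁻ c∈) ∷ ∈-below⁻ a′∈

χ₀ χ₁ χ₊ : ℕ → ℚ
χ₀ zero = 1ℚ
χ₀ (suc _) = 0ℚ
χ₁ (suc zero) = 1ℚ
χ₁ _ = 0ℚ
χ₊ zero = 0ℚ
χ₊ (suc _) = 1ℚ

-- The constant 1 and the variable xᵢ are written as products of one-variable
-- indicators, so that sums over `below m` against them factor coordinatewise.
oneP : ∀ {n} → Poly n
oneP [] = 1ℚ
oneP (c ∷ a) = χ₀ c * oneP a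

var : ∀ {n} → Fin n → Poly n
var zero (c ∷ a) = χ₁ c * oneP a
var (suc i) (c ∷ a) = χ₀ c * var i a

basis : ∀ {n} → Fin n → Mono n
basis {suc n} zero = 1 ∷ replicate n 0
basis (suc i) = 0 ∷ basis i

sumMap-χ₀ : ∀ k (g : ℕ → ℚ) → sumMap (λ c → χ₀ c * g c) (upTo (suc k)) ≡ g 0
sumMap-χ₀ k g = begin
  sumMap (λ c → χ₀ c * g c) (upTo (suc k))
    ≡⟨ sumMap-upTo-suc (λ c → χ₀ c * g c) k ⟩
  1ℚ * g 0 + sumMap (λ c → 0ℚ * g (suc c)) (upTo k)
    ≡⟨ cong₂ _+_ (*-identityˡ (g 0)) (sumMap-zero (λ c → *-zeroˡ (g (suc c))) (upTo k)) ⟩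
  g 0 + 0ℚ
    ≡⟨ +-identityʳ (g 0) ⟩
  g 0 ∎

sumMap-χ₁ : ∀ k (g : ℕ → ℚ) → sumMap (λ c → χ₁ c * g c) (upTo (suc k)) ≡ χ₊ k * g 1
sumMap-χ₁ zero g = trans (+-identityʳ _) (trans (*-zeroˡ (g 0)) (sym (*-zeroˡ (g 1))))
sumMap-χ₁ (suc k) g = begin
  sumMap (λ c → χ₁ c * g c) (upTo (suc (suc k)))
    ≡⟨ sumMap-upTo-suc (λ c → χ₁ c * g c) (suc k) ⟩
  0ℚ * g 0 + sumMap (λ c → χ₁ (suc c) * g (suc c)) (upTo (suc k))
    ≡⟨ cong₂ _+_ (*-zeroˡ (g 0)) (sumMap-upTo-suc (λ c → χ₁ (suc c) * g (suc c)) k) ⟩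
  0ℚ + (1ℚ * g 1 + sumMap (λ c → 0ℚ * g (suc (suc c))) (upTo k))
    ≡⟨ +-identityˡ _ ⟩
  1ℚ * g 1 + sumMap (λ c → 0ℚ * g (suc (suc c))) (upTo k)
    ≡⟨ cong (1ℚ * g 1 +_) (sumMap-zero (λ c → *-zeroˡ (g (suc (suc c)))) (upTo k)) ⟩
  1ℚ * g 1 + 0ℚ
    ≡⟨ +-identityʳ _ ⟩
  1ℚ * g 1 ∎

sumMap-oneP-* : ∀ {n} (m : Mono n) (F : Mono n → ℚ) → sumMap (λ a → oneP a * F a) (below m) ≡ F (replicate n 0)
sumMap-oneP-* [] F = trans (+-identityʳ _) (*-identityˡ _)
sumMap-oneP-* (k ∷ m) F = begin
  sumMap (λ a → oneP a * F a) (below (k ∷ m))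
    ≡⟨ sumMap-below-∷ _ k m ⟩
  sumMap (λ c → sumMap (λ a → (χ₀ c * oneP a) * F (c ∷ a)) (below m)) (upTo (suc k))
    ≡⟨ sumMap-cong (λ c → trans (sumMap-cong (λ a → xy∙z≈y∙xz (χ₀ c) (oneP a) _) (below m))
                                (sumMap-oneP-* m (λ a → χ₀ c * F (c ∷ a)))) (upTo (suc k)) ⟩
  sumMap (λ c → χ₀ c * F (c ∷ replicate _ 0)) (upTo (suc k))
    ≡⟨ sumMap-χ₀ k (λ c → F (c ∷ replicate _ 0)) ⟩
  F (replicate _ 0) ∎

sumMap-var-* : ∀ {n} (i : Fin n) (m : Mono n) (F : Mono n → ℚ) →
            sumMap (λ a → var i a * F a) (below m) ≡ χ₊ (lookup m i) * F (basis i)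
sumMap-var-* zero (k ∷ m) F = begin
  sumMap (λ a → var zero a * F a) (below (k ∷ m))
    ≡⟨ sumMap-below-∷ _ k m ⟩
  sumMap (λ c → sumMap (λ a → (χ₁ c * oneP a) * F (c ∷ a)) (below m)) (upTo (suc k))
    ≡⟨ sumMap-cong (λ c → trans (sumMap-cong (λ a → xy∙z≈y∙xz (χ₁ c) (oneP a) _) (below m))
                                (sumMap-oneP-* m (λ a → χ₁ c * F (c ∷ a)))) (upTo (suc k)) ⟩
  sumMap (λ c → χ₁ c * F (c ∷ replicate _ 0)) (upTo (suc k))
    ≡⟨ sumMap-χ₁ k (λ c → F (c ∷ replicate _ 0)) ⟩
  χ₊ k * F (basis zero) ∎
sumMap-var-* (suc i) (k ∷ m) F = begin
  sumMap (λ a → var (suc i) a * F a) (below (k ∷ m))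
    ≡⟨ sumMap-below-∷ _ k m ⟩
  sumMap (λ c → sumMap (λ a → (χ₀ c * var i a) * F (c ∷ a)) (below m)) (upTo (suc k))
    ≡⟨ sumMap-cong (λ c → trans (sumMap-cong (λ a → xy∙z≈y∙xz (χ₀ c) (var i a) _) (below m))
                         (trans (sumMap-var-* i m (λ a → χ₀ c * F (c ∷ a)))
                                (x∙yz≈y∙xz (χ₊ (lookup m i)) (χ₀ c) _))) (upTo (suc k)) ⟩
  sumMap (λ c → χ₀ c * (χ₊ (lookup m i) * F (c ∷ basis i))) (upTo (suc k))
    ≡⟨ sumMap-χ₀ k (λ c → χ₊ (lookup m i) * F (c ∷ basis i)) ⟩
  χ₊ (lookup m i) * F (basis (suc i)) ∎

-- m ∸ eᵢ is truncated; when mᵢ = 0 the factor χ₊ mᵢ = 0 makes this harmless.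
mulP-var : ∀ {n} (i : Fin n) (G : Poly n) m → mulP (var i) G m ≡ χ₊ (lookup m i) * G (zipWith _∸_ m (basis i))
mulP-var i G m = sumMap-var-* i m (λ a → G (zipWith _∸_ m a))

incAt : ∀ {n} → Fin n → Mono n → Mono n
incAt i b = updateAt b i suc

mdeg-incAt : ∀ {n} (i : Fin n) (b : Mono n) → mdeg (incAt i b) ≡ suc (mdeg b)
mdeg-incAt zero (c ∷ b) = refl
mdeg-incAt (suc i) (c ∷ b) = trans (cong (c +ℕ_) (mdeg-incAt i b)) (+-suc c (mdeg b))

incAt-∸basis : ∀ {n} (i : Fin n) (m : Mono n) {t} → lookup m i ≡ suc t → incAt i (zipWith _∸_ m (basis i)) ≡ m
incAt-∸basis zero (suc c ∷ m) _ = cong (suc c ∷_) (zipWith-identityʳ (λ _ → refl) m)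
incAt-∸basis (suc i) (c ∷ m) mᵢ≡ = cong (c ∷_) (incAt-∸basis i m mᵢ≡)

IsForm-oneP : ∀ {n} → IsForm 0 (oneP {n})
IsForm-oneP [] ne = ⊥-elim (ne refl)
IsForm-oneP (zero ∷ a) ne = trans (*-identityˡ _) (IsForm-oneP a ne)
IsForm-oneP (suc c ∷ a) ne = *-zeroˡ (oneP a)

IsForm-var : ∀ {n} (i : Fin n) → IsForm 1 (var i)
IsForm-var zero (zero ∷ a) ne = *-zeroˡ (oneP a)
IsForm-var zero (suc zero ∷ a) ne = trans (*-identityˡ _) (IsForm-oneP a (ne ∘ cong suc))
IsForm-var zero (suc (suc c) ∷ a) ne = *-zeroˡ (oneP a)
IsForm-var (suc i) (zero ∷ a) ne = trans (*-identityˡ _) (IsForm-var i a ne)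
IsForm-var (suc i) (suc c ∷ a) ne = *-zeroˡ (var i a)

IsForm-sumFin : ∀ {n} e h (g : Fin h → Poly n) → (∀ k → IsForm e (g k)) → IsForm e (sumFin h g)
IsForm-sumFin e zero g g-forms m ne = refl
IsForm-sumFin e (suc h) g g-forms m ne =
  trans (cong₂ _+_ (g-forms zero m ne) (IsForm-sumFin e h (g ∘ suc) (g-forms ∘ suc) m ne)) (+-identityˡ 0ℚ)

IsForm-comb : ∀ {n r} e (μ : Fin r → ℚ) (fs : Fin r → Poly n) → (∀ j → IsForm e (fs j)) → IsForm e (comb μ fs)
IsForm-comb {r = r} e μ fs fs-forms =
  IsForm-sumFin e r _ (λ j m ne → trans (cong (μ j *_) (fs-forms j m ne)) (*-zeroʳ (μ j)))

module _ {n : ℕ} (i : Fin n) where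

  restrict-≡0 : ∀ (p : Poly n) m → lookup m i ≡ 0 → restrict i p m ≡ p m
  restrict-≡0 p m mᵢ≡0 rewrite mᵢ≡0 = refl

  restrict-≡suc : ∀ (p : Poly n) m {t} → lookup m i ≡ suc t → restrict i p m ≡ 0ℚ
  restrict-≡suc p m mᵢ≡ rewrite mᵢ≡ = refl

  restrict-cong : ∀ {p q : Poly n} → (∀ m → p m ≡ q m) → ∀ m → restrict i p m ≡ restrict i q m
  restrict-cong p≗q m with lookup m i
  ... | zero = p≗q m
  ... | suc _ = refl

  restrict-addP : ∀ (p q : Poly n) m → restrict i (addP p q) m ≡ restrict i p m + restrict i q m
  restrict-addP p q m with lookup m i
  ... | zero = refl
  ... | suc _ = sym (+-identityʳ 0ℚ)

  restrict-scaleP : ∀ c (p : Poly n) m → restrict i (scaleP c p) m ≡ c * restrict i p m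
  restrict-scaleP c p m with lookup m i
  ... | zero = refl
  ... | suc _ = sym (*-zeroʳ c)

  restrict-sumFin : ∀ h (g : Fin h → Poly n) m → restrict i (sumFin h g) m ≡ sumFin h (restrict i ∘ g) m
  restrict-sumFin zero g m with lookup m i
  ... | zero = refl
  ... | suc _ = refl
  restrict-sumFin (suc h) g m =
    trans (restrict-addP (g zero) _ m) (cong (restrict i (g zero) m +_) (restrict-sumFin h (g ∘ suc) m))

  restrict-comb : ∀ {r} (μ : Fin r → ℚ) (fs : Fin r → Poly n) m →
                  restrict i (comb μ fs) m ≡ comb μ (restrict i ∘ fs) m
  restrict-comb {r} μ fs m =
    trans (restrict-sumFin r _ m) (sumFin-cong r (λ j → restrict-scaleP (μ j) (fs j)) m)

  -- A term U_a V_{m−a} survives only if x_i occurs in neither factor, i.e. only if mᵢ = 0.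
  restrict-mulP : ∀ (U V : Poly n) m → restrict i (mulP U V) m ≡ mulP (restrict i U) (restrict i V) m
  restrict-mulP U V m with lookup m i in mᵢ≡
  ... | zero = sumMap-cong-∈ (below m) λ {a} a∈ →
    let aᵢ≡0 = n≤0⇒n≡0 (subst (lookup a i ≤_) mᵢ≡ (Pointwise.lookup (∈-below⁻ {m = m} a∈) i))
        [m∸a]ᵢ≡0 = trans (lookup-zipWith _∸_ i m a) (trans (cong (_∸ lookup a i) mᵢ≡) (0∸n≡0 (lookup a i)))
    in sym (cong₂ _*_ (restrict-≡0 U a aᵢ≡0) (restrict-≡0 V (zipWith _∸_ m a) [m∸a]ᵢ≡0))
  ... | suc t = sym (sumMap-zero vanish (below m))
    where
    vanish : ∀ a → restrict i U a * restrict i V (zipWith _∸_ m a) ≡ 0ℚ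
    vanish a with lookup a i in aᵢ≡
    ... | suc _ = *-zeroˡ (restrict i V (zipWith _∸_ m a))
    ... | zero =
      let [m∸a]ᵢ≡ = trans (lookup-zipWith _∸_ i m a) (cong₂ _∸_ mᵢ≡ aᵢ≡)
      in trans (cong (U a *_) (restrict-≡suc V (zipWith _∸_ m a) [m∸a]ᵢ≡)) (*-zeroʳ (U a))

  IsForm-restrict : ∀ {e} {p : Poly n} → IsForm e p → IsForm e (restrict i p)
  IsForm-restrict p-form m ne with lookup m i
  ... | zero = p-form m ne
  ... | suc _ = refl

  divVar : Poly n → Poly n
  divVar p b = p (incAt i b)

  IsForm-divVar : ∀ {e} {p : Poly n} → IsForm (suc e) p → IsForm e (divVar p)
  IsForm-divVar p-form b ne = p-form (incAt i b) (ne ∘ suc-injective ∘ trans (sym (mdeg-incAt i b)))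

  split-var : ∀ (p : Poly n) m → p m ≡ mulP (var i) (divVar p) m + restrict i p m
  split-var p m = trans split (cong (_+ restrict i p m) (sym (mulP-var i (divVar p) m)))
    where
    split : p m ≡ χ₊ (lookup m i) * divVar p (zipWith _∸_ m (basis i)) + restrict i p m
    split with lookup m i in mᵢ≡
    ... | zero = sym (trans (cong (_+ p m) (*-zeroˡ (divVar p (zipWith _∸_ m (basis i))))) (+-identityˡ (p m)))
    ... | suc _ = sym (trans (+-identityʳ _) (trans (*-identityˡ _) (cong p (incAt-∸basis i m mᵢ≡))))

  HasRep-restrict : ∀ {f : Poly n} {h} → HasRep f h → HasRep (restrict i f) h
  HasRep-restrict {f} {h} (U , V , U-forms , V-forms , f≡) =
    restrict i ∘ U , restrict i ∘ V ,
    map₂ (map₂ IsForm-restrict) ∘ U-forms , map₂ (map₂ IsForm-restrict) ∘ V-forms ,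
    λ m → begin
      restrict i f m
        ≡⟨ restrict-cong f≡ m ⟩
      restrict i (sumFin h (λ k → mulP (U k) (V k))) m
        ≡⟨ restrict-sumFin h _ m ⟩
      sumFin h (λ k → restrict i (mulP (U k) (V k))) m
        ≡⟨ sumFin-cong h (λ k → restrict-mulP (U k) (V k)) m ⟩
      sumFin h (λ k → mulP (restrict i (U k)) (restrict i (V k))) m ∎

  HasRep-suc-of-restrict : ∀ {d} {f : Poly n} {h} → 2 ≤ d → IsForm d f → HasRep (restrict i f) h → HasRep f (suc h)
  HasRep-suc-of-restrict {f = f} (s≤s (s≤s _)) f-form (U , V , U-forms , V-forms , f≡) =
    var i Vector.∷ U , divVar f Vector.∷ V ,
    (λ { zero → 1 , ≤-refl , IsForm-var i ; (suc k) → U-forms k }) ,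
    (λ { zero → _ , s≤s z≤n , IsForm-divVar f-form ; (suc k) → V-forms k }) ,
    λ m → trans (split-var f m) (cong (mulP (var i) (divVar f) m +_) (f≡ m))

HasRep-cong : ∀ {n} {f g : Poly n} {h} → (∀ m → f m ≡ g m) → HasRep f h → HasRep g h
HasRep-cong f≗g (U , V , U-forms , V-forms , f≡) = U , V , U-forms , V-forms , λ m → trans (sym (f≗g m)) (f≡ m)

lemma2p2 : (n r d : ℕ) → 2 ≤ d → (fs : Fin r → Poly n) → (∀ j → IsForm d (fs j)) →
           (k : ℕ) → IsHSys fs k → 2 ≤ k → (i : Fin n) →
           (k′ : ℕ) → IsHSys (λ j → restrict i (fs j)) k′ →
           (k ∸ 1 ≤ k′) × (k′ ≤ k)
lemma2p2 n r d 2≤d fs fs-forms k ((μ , μ≢0 , rep , _) , k-min) _ i k′ ((μ′ , μ′≢0 , rep′ , _) , k′-min) =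
  ∸-monoˡ-≤ 1 (k-min μ′ μ′≢0 (suc k′) extended) , k′-min μ μ≢0 k restricted
  where
  restricted : HasRep (comb μ (restrict i ∘ fs)) k
  restricted = HasRep-cong (restrict-comb i μ fs) (HasRep-restrict i rep)

  extended : HasRep (comb μ′ fs) (suc k′)
  extended = HasRep-suc-of-restrict i 2≤d (IsForm-comb d μ′ fs fs-forms)
               (HasRep-cong (sym ∘ restrict-comb i μ′ fs) rep′)
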